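{- For all integers $k \geq 1$, $$A_{\mathbf{r}}(2^k+1) = \begin{cases} 5 & k=1,\\ 6 & k=2,\\ 9 & k=3,\\ 2^{k-1}+2 & k\geq 4.\end{cases}$$
   Context: $\mathbb{N}=\{0,1,2,\dots\}$. For $n\in\mathbb{N}$, $e_{11}(n)$ denotes the number of (possibly overlapping) occurrences of the block $11$ in the binary expansion of $n$, and $r_n = e_{11}(n) \bmod 2$ (Rudin--Shapiro sequence). For $n,d\in\mathbb{N}$, $d\geq1$, let $A_{\mathbf{r}}(n,d)=\inf\{l\geq 1: r_{n+ld}\neq r_n\}$ and $A_{\mathbf{r}}(d)=\sup_{n\in\mathbb{N}} A_{\mathbf{r}}(n,d)$. -}

module Defs where

open import Data.Nat using (ℕ; zero; suc; _+_; _*_; _^_; _≤_; _<_; _%_; _/_)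
open import Data.Nat.Properties using (_≟_)
open import Data.Bool using (Bool; true; false; if_then_else_)
open import Relation.Nullary.Decidable using (⌊_⌋)
open import Relation.Binary.PropositionalEquality using (_≡_; _≢_)
open import Data.Product using (∃; _×_)

-- Number of (possibly overlapping) occurrences of the block 11 in the binary
-- expansion of n.  Each step inspects the two lowest bits (n % 4 ≡ 3 means
-- both are 1) and then shifts right; the fuel argument (initialised to n)
-- is always sufficient since n / 2^n = 0.
e11-fuel : ℕ → ℕ → ℕ
e11-fuel zero    n = 0
e11-fuel (suc f) n = (if ⌊ n % 4 ≟ 3 ⌋ then 1 else 0) + e11-fuel f (n / 2)

e11 : ℕ → ℕ
e11 n = e11-fuel n n

r : ℕ → ℕ
r n = e11 n % 2

-- A_r(n,d) ≤ v : some l with 1 ≤ l ≤ v has r(n+ld) ≠ r(n)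
A≤ : ℕ → ℕ → ℕ → Set
A≤ n d v = ∃ λ l → 1 ≤ l × l ≤ v × r (n + l * d) ≢ r n

-- v ≤ A_r(n,d) : r(n+ld) = r(n) for all 1 ≤ l < v
A≥ : ℕ → ℕ → ℕ → Set
A≥ n d v = ∀ l → 1 ≤ l → l < v → r (n + l * d) ≡ r n

-- A_r(d) = v  (sup over n of A_r(n,d), with inf ∅ = ∞ and sup in ℕ ∪ {∞}):
-- every A_r(n,d) is ≤ v, and some A_r(n,d) is ≥ v.
A≡ : ℕ → ℕ → Set
A≡ d v = (∀ n → A≤ n d v) × ∃ λ n → A≥ n d v

-- Write n = a K + b with K = 2^k and b < K. While b + l < K the walk n + l (K + 1)
-- visits (a + l) K + (b + l), and rs (a K + b) = rs a ⊕ rs b ⊕ (a odd ∧ b ≥ K/2).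
-- So, with δ m = rs m ⊕ rs (m + 1), the step from l to l + 1 changes rs iff
-- δ (a + l) ≠ δ (b + l) while b + l is in the lower half of the block, and iff
-- δ (a + l) = δ (b + l) in the upper half. On 15 consecutive arguments δ depends only
-- on the residue of the start mod 16 and on the parity and δ of its quotient by 16,
-- so a finite check shows that two δ-windows agree within 14 steps, agree within
-- 2 steps when their starts are congruent mod 4, and disagree within 7 steps
-- otherwise. Steering the walk into the suitable half, or past the wrap b = K onto
-- (U 2^s , 0) with U odd, where the change comes after 2^(s-1) steps, yields a
-- change within K/2 + 2 steps; the point (2K - 1) K + (K - 1) shows this is sharp.
-- For k ≤ 5 both bounds are checked by exhaustive computation on residues.
module Submission where

open import Defs
open import Data.Nat
open import Data.Nat.Properties
open import Data.Nat.DivMod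
open import Data.Nat.Divisibility using (_∣_; divides; divides-refl)
open import Data.Nat.Tactic.RingSolver using (solve-∀)
open import Data.Bool using (Bool; true; false; not; _∧_; _xor_; if_then_else_; T)
open import Data.Bool.Properties
  using (xor-same; xor-comm; xor-identityʳ; true-xor; not-distribˡ-xor; ∧-zeroʳ; ∧-identityʳ)
  renaming (_≟_ to _≟ᵇ_)
open import Data.Bool.Solver using (module xor-∧-Solver)
open import Data.Empty using (⊥-elim)
open import Data.Product using (∃; ∃₂; _×_; _,_; proj₁; proj₂)
open import Data.Sum using (_⊎_; inj₁; inj₂)
open import Data.Unit using (tt)
open import Function using (_∘_)
open import Relation.Binary.PropositionalEquality
open import Relation.Nullary using (Dec; yes; no; ¬?)
open import Relation.Nullary.Decidable using (map′; _×-dec_; _→-dec_; True; toWitness; ⌊_⌋)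

toℕ : Bool → ℕ
toℕ false = 0
toℕ true  = 1

odd : ℕ → Bool
odd n = n % 2 ≡ᵇ 1

toℕ<2 : ∀ b → toℕ b < 2
toℕ<2 false = s≤s z≤n
toℕ<2 true  = s≤s (s≤s z≤n)

toℕ-odd : ∀ n → toℕ (odd n) ≡ n % 2
toℕ-odd n with n % 2 | m%n<n n 2
... | 0           | _ = refl
... | 1           | _ = refl
... | suc (suc _) | s≤s (s≤s ())

odd-toℕ : ∀ b → odd (toℕ b) ≡ b
odd-toℕ false = refl
odd-toℕ true  = refl

n≡odd+[n/2]*2 : ∀ n → n ≡ toℕ (odd n) + n / 2 * 2
n≡odd+[n/2]*2 n = trans (m≡m%n+[m/n]*n n 2) (cong (_+ n / 2 * 2) (sym (toℕ-odd n)))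

[b+m*2]/2≡m : ∀ b m → (toℕ b + m * 2) / 2 ≡ m
[b+m*2]/2≡m b m = begin
  (toℕ b + m * 2) / 2     ≡⟨ +-distrib-/-∣ʳ (toℕ b) (divides-refl m) ⟩
  toℕ b / 2 + m * 2 / 2   ≡⟨ cong₂ _+_ (m<n⇒m/n≡0 (toℕ<2 b)) (m*n/n≡m m 2) ⟩
  m                       ∎
  where open ≡-Reasoning

odd-b+m*2 : ∀ b m → odd (toℕ b + m * 2) ≡ b
odd-b+m*2 false m = cong (_≡ᵇ 1) ([m+kn]%n≡m%n 0 m 2)
odd-b+m*2 true  m = cong (_≡ᵇ 1) ([m+kn]%n≡m%n 1 m 2)

odd-m*2 : ∀ m → odd (m * 2) ≡ false
odd-m*2 = odd-b+m*2 false

odd-2*m : ∀ m → odd (2 * m) ≡ false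
odd-2*m m = trans (cong odd (*-comm 2 m)) (odd-m*2 m)

odd-suc : ∀ n → odd (suc n) ≡ not (odd n)
odd-suc n = begin
  odd (suc n)                          ≡⟨ cong (odd ∘ suc) (n≡odd+[n/2]*2 n) ⟩
  odd (suc (toℕ (odd n) + n / 2 * 2))  ≡⟨ odd-1+b+q*2 (odd n) (n / 2) ⟩
  not (odd n)                          ∎
  where
  open ≡-Reasoning
  odd-1+b+q*2 : ∀ b q → odd (suc (toℕ b + q * 2)) ≡ not b
  odd-1+b+q*2 false q = odd-b+m*2 true q
  odd-1+b+q*2 true  q = odd-b+m*2 false (suc q)

odd-+ : ∀ m n → odd (m + n) ≡ odd m xor odd n
odd-+ zero    n = refl
odd-+ (suc m) n = begin
  odd (suc (m + n))        ≡⟨ odd-suc (m + n) ⟩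
  not (odd (m + n))        ≡⟨ cong not (odd-+ m n) ⟩
  not (odd m xor odd n)    ≡⟨ not-distribˡ-xor (odd m) (odd n) ⟩
  not (odd m) xor odd n    ≡⟨ cong (_xor odd n) (odd-suc m) ⟨
  odd (suc m) xor odd n    ∎
  where open ≡-Reasoning

odd-m*2+n : ∀ m n → odd (m * 2 + n) ≡ odd n
odd-m*2+n m n = trans (odd-+ (m * 2) n) (cong (_xor odd n) (odd-m*2 m))

odd⇒%4≢0 : ∀ m → odd m ≡ true → m % 4 ≢ 0
odd⇒%4≢0 m odd-m m%4≡0 = false≢true (begin
  false          ≡⟨⟩
  0 % 2 ≡ᵇ 1     ≡⟨ cong (λ r → r % 2 ≡ᵇ 1) m%4≡0 ⟨
  m % 4 % 2 ≡ᵇ 1 ≡⟨ cong (_≡ᵇ 1) (m∣n⇒o%n%m≡o%m 2 4 m (divides 2 refl)) ⟩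
  odd m          ≡⟨ odd-m ⟩
  true           ∎)
  where open ≡-Reasoning
        false≢true : false ≢ true
        false≢true ()

%-cong-+ʳ : ∀ m n o → m % 4 ≡ n % 4 → (m + o) % 4 ≡ (n + o) % 4
%-cong-+ʳ m n o m≡n = begin
  (m + o) % 4             ≡⟨ %-distribˡ-+ m o 4 ⟩
  (m % 4 + o % 4) % 4     ≡⟨ cong (λ r → (r + o % 4) % 4) m≡n ⟩
  (n % 4 + o % 4) % 4     ≡⟨ %-distribˡ-+ n o 4 ⟨
  (n + o) % 4             ∎
  where open ≡-Reasoning

n<2^n : ∀ n → n < 2 ^ n
n<2^n zero    = s≤s z≤n
n<2^n (suc n) = begin-strict
  suc n          <⟨ s≤s (n<2^n n) ⟩
  suc (2 ^ n)    ≤⟨ +-monoˡ-≤ (2 ^ n) (m^n>0 2 n) ⟩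
  2 ^ n + 2 ^ n  ≡⟨ cong (2 ^ n +_) (+-identityʳ (2 ^ n)) ⟨
  2 ^ suc n      ∎
  where open ≤-Reasoning

m<2^[1+n]⇒m/2<2^n : ∀ m n → m < 2 ^ suc n → m / 2 < 2 ^ n
m<2^[1+n]⇒m/2<2^n m n m< = m<n*o⇒m/o<n (subst (m <_) (*-comm 2 (2 ^ n)) m<)

bit : ℕ → ℕ → Bool
bit zero    n = odd n
bit (suc i) n = bit i (n / 2)

bit-< : ∀ i y → y < 2 ^ i → bit i y ≡ false
bit-< zero    zero    _        = refl
bit-< zero    (suc y) (s≤s ())
bit-< (suc i) y       y<       = bit-< i (y / 2) (m<2^[1+n]⇒m/2<2^n y i y<)

bit-≥ : ∀ i y → 2 ^ i ≤ y → y < 2 ^ suc i → bit i y ≡ true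
bit-≥ zero    (suc zero)    _     _                = refl
bit-≥ zero    (suc (suc y)) _     (s≤s (s≤s ()))
bit-≥ (suc i) y             2^i≤y y<               = bit-≥ i (y / 2) 2^i≤y/2 (m<2^[1+n]⇒m/2<2^n y (suc i) y<)
  where 2^i≤y/2 : 2 ^ i ≤ y / 2
        2^i≤y/2 = subst (_≤ y / 2) (trans (cong (_/ 2) (*-comm 2 (2 ^ i))) (m*n/n≡m (2 ^ i) 2)) (/-monoˡ-≤ 2 2^i≤y)

2^t∣⊎odd*2^s : ∀ t u → 2 ^ t ∣ u ⊎ ∃₂ λ s U → s < t × odd U ≡ true × u ≡ U * 2 ^ s
2^t∣⊎odd*2^s zero    u = inj₁ (divides u (sym (*-identityʳ u)))
2^t∣⊎odd*2^s (suc t) u with 2^t∣⊎odd*2^s t u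
... | inj₂ (s , U , s<t , odd-U , u≡) = inj₂ (s , U , m<n⇒m<1+n s<t , odd-U , u≡)
... | inj₁ (divides X u≡) with odd X in odd-X
...   | true  = inj₂ (t , X , ≤-refl , odd-X , u≡)
...   | false = inj₁ (divides (X / 2) (begin
  u                                  ≡⟨ u≡ ⟩
  X * 2 ^ t                          ≡⟨ cong (_* 2 ^ t) (n≡odd+[n/2]*2 X) ⟩
  (toℕ (odd X) + X / 2 * 2) * 2 ^ t  ≡⟨ cong (λ b → (toℕ b + X / 2 * 2) * 2 ^ t) odd-X ⟩
  X / 2 * 2 * 2 ^ t                  ≡⟨ *-assoc (X / 2) 2 (2 ^ t) ⟩
  X / 2 * 2 ^ suc t                  ∎))
  where open ≡-Reasoning

-- The Rudin–Shapiro recurrence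

e11-fuel-zero : ∀ f → e11-fuel f 0 ≡ 0
e11-fuel-zero zero    = refl
e11-fuel-zero (suc f) = e11-fuel-zero f

e11-fuel-irrelevant : ∀ f g n → n < 2 ^ f → n < 2 ^ g → e11-fuel f n ≡ e11-fuel g n
e11-fuel-irrelevant zero    g       zero    _ _ = sym (e11-fuel-zero g)
e11-fuel-irrelevant (suc f) zero    zero    _ _ = e11-fuel-zero (suc f)
e11-fuel-irrelevant zero    g       (suc n) (s≤s ()) _
e11-fuel-irrelevant (suc f) zero    (suc n) _ (s≤s ())
e11-fuel-irrelevant (suc f) (suc g) n       n<2^f n<2^g =
  cong ((if ⌊ n % 4 ≟ 3 ⌋ then 1 else 0) +_)
       (e11-fuel-irrelevant f g (n / 2) (m<2^[1+n]⇒m/2<2^n n f n<2^f) (m<2^[1+n]⇒m/2<2^n n g n<2^g))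

e11≡e11-fuel : ∀ f n → n < 2 ^ f → e11 n ≡ e11-fuel f n
e11≡e11-fuel f n = e11-fuel-irrelevant n f n (n<2^n n)

b+m*2<2^[1+m] : ∀ b m → toℕ b + m * 2 < 2 ^ suc m
b+m*2<2^[1+m] b m = begin-strict
  toℕ b + m * 2  <⟨ +-monoˡ-< (m * 2) (toℕ<2 b) ⟩
  suc m * 2      ≤⟨ *-monoˡ-≤ 2 (n<2^n m) ⟩
  2 ^ m * 2      ≡⟨ *-comm (2 ^ m) 2 ⟩
  2 ^ suc m      ∎
  where open ≤-Reasoning

[b+m*2]%4 : ∀ b m → (toℕ b + m * 2) % 4 ≡ toℕ b + toℕ (odd m) * 2
[b+m*2]%4 b m = begin
  (toℕ b + m * 2) % 4                          ≡⟨ cong (λ m → (toℕ b + m * 2) % 4) (n≡odd+[n/2]*2 m) ⟩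
  (toℕ b + (toℕ (odd m) + m / 2 * 2) * 2) % 4  ≡⟨ cong (_% 4) (regroup (toℕ b) (toℕ (odd m)) (m / 2)) ⟩
  (toℕ b + toℕ (odd m) * 2 + m / 2 * 4) % 4    ≡⟨ [m+kn]%n≡m%n (toℕ b + toℕ (odd m) * 2) (m / 2) 4 ⟩
  (toℕ b + toℕ (odd m) * 2) % 4                ≡⟨ m<n⇒m%n≡m (+-mono-<-≤ (toℕ<2 b) (*-monoˡ-≤ 2 (≤-pred (toℕ<2 (odd m))))) ⟩
  toℕ b + toℕ (odd m) * 2                      ∎
  where
  open ≡-Reasoning
  regroup : ∀ x y z → x + (y + z * 2) * 2 ≡ x + y * 2 + z * 4
  regroup = solve-∀

11-indicator : ∀ b c → (if ⌊ toℕ b + toℕ c * 2 ≟ 3 ⌋ then 1 else 0) ≡ toℕ (b ∧ c)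
11-indicator false false = refl
11-indicator false true  = refl
11-indicator true  false = refl
11-indicator true  true  = refl

e11-b+m*2 : ∀ b m → e11 (toℕ b + m * 2) ≡ toℕ (b ∧ odd m) + e11 m
e11-b+m*2 b m = begin
  e11 (toℕ b + m * 2)
    ≡⟨ e11≡e11-fuel (suc m) _ (b+m*2<2^[1+m] b m) ⟩
  (if ⌊ (toℕ b + m * 2) % 4 ≟ 3 ⌋ then 1 else 0) + e11-fuel m ((toℕ b + m * 2) / 2)
    ≡⟨ cong₂ (λ u v → (if ⌊ u ≟ 3 ⌋ then 1 else 0) + e11-fuel m v) ([b+m*2]%4 b m) ([b+m*2]/2≡m b m) ⟩
  (if ⌊ toℕ b + toℕ (odd m) * 2 ≟ 3 ⌋ then 1 else 0) + e11 m
    ≡⟨ cong (_+ e11 m) (11-indicator b (odd m)) ⟩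
  toℕ (b ∧ odd m) + e11 m ∎
  where open ≡-Reasoning

rs : ℕ → Bool
rs n = odd (e11 n)

rs≢⇒r≢ : ∀ m n → rs m ≢ rs n → r m ≢ r n
rs≢⇒r≢ m n rs≢ r≡ = rs≢ (cong (_≡ᵇ 1) r≡)

rs≡⇒r≡ : ∀ m n → rs m ≡ rs n → r m ≡ r n
rs≡⇒r≡ m n rs≡ = trans (sym (toℕ-odd (e11 m))) (trans (cong toℕ rs≡) (toℕ-odd (e11 n)))

rs-b+m*2 : ∀ b m → rs (toℕ b + m * 2) ≡ rs m xor (b ∧ odd m)
rs-b+m*2 b m = begin
  odd (e11 (toℕ b + m * 2))       ≡⟨ cong odd (e11-b+m*2 b m) ⟩
  odd (toℕ (b ∧ odd m) + e11 m)   ≡⟨ odd-+ (toℕ (b ∧ odd m)) (e11 m) ⟩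
  odd (toℕ (b ∧ odd m)) xor rs m  ≡⟨ cong (_xor rs m) (odd-toℕ (b ∧ odd m)) ⟩
  (b ∧ odd m) xor rs m            ≡⟨ xor-comm (b ∧ odd m) (rs m) ⟩
  rs m xor (b ∧ odd m)            ∎
  where open ≡-Reasoning

-- y is written with i + 1 digits; a block 11 may straddle the junction.
rs-concat : ∀ i x y → y < 2 ^ suc i → rs (x * 2 ^ suc i + y) ≡ (rs x xor rs y) xor (odd x ∧ bit i y)
rs-concat zero x 0 _ = begin
  rs (x * 2 + 0)                        ≡⟨ cong rs (+-identityʳ (x * 2)) ⟩
  rs (0 + x * 2)                        ≡⟨ rs-b+m*2 false x ⟩
  rs x xor false                        ≡⟨ xor-identityʳ (rs x xor false) ⟨
  (rs x xor false) xor false            ≡⟨ cong ((rs x xor false) xor_) (∧-zeroʳ (odd x)) ⟨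
  (rs x xor false) xor (odd x ∧ false)  ∎
  where open ≡-Reasoning
rs-concat zero x 1 _ = begin
  rs (x * 2 + 1)                        ≡⟨ cong rs (+-comm (x * 2) 1) ⟩
  rs (1 + x * 2)                        ≡⟨ rs-b+m*2 true x ⟩
  rs x xor odd x                        ≡⟨ cong₂ _xor_ (xor-identityʳ (rs x)) (∧-identityʳ (odd x)) ⟨
  (rs x xor false) xor (odd x ∧ true)   ∎
  where open ≡-Reasoning
rs-concat zero x (suc (suc y)) (s≤s (s≤s ()))
rs-concat (suc i) x y y< = begin
  rs (x * 2 ^ suc (suc i) + y)
    ≡⟨ cong rs split-last-digit ⟩
  rs (toℕ c + (x * 2 ^ suc i + y′) * 2)
    ≡⟨ rs-b+m*2 c (x * 2 ^ suc i + y′) ⟩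
  rs (x * 2 ^ suc i + y′) xor (c ∧ odd (x * 2 ^ suc i + y′))
    ≡⟨ cong₂ (λ u v → u xor (c ∧ v)) (rs-concat i x y′ y′<) odd-x2^[1+i]+y′ ⟩
  ((rs x xor rs y′) xor (odd x ∧ bit i y′)) xor (c ∧ odd y′)
    ≡⟨ solve 4 (λ a b p q → ((a :+ b) :+ p) :+ q := (a :+ (b :+ q)) :+ p) refl (rs x) (rs y′) (odd x ∧ bit i y′) (c ∧ odd y′) ⟩
  (rs x xor (rs y′ xor (c ∧ odd y′))) xor (odd x ∧ bit i y′)
    ≡⟨ cong (λ u → (rs x xor u) xor (odd x ∧ bit i y′)) (trans (cong rs (n≡odd+[n/2]*2 y)) (rs-b+m*2 c y′)) ⟨
  (rs x xor rs y) xor (odd x ∧ bit (suc i) y) ∎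
  where
  open ≡-Reasoning
  open xor-∧-Solver
  c  = odd y
  y′ = y / 2
  y′< : y′ < 2 ^ suc i
  y′< = m<2^[1+n]⇒m/2<2^n y (suc i) y<
  odd-x2^[1+i]+y′ : odd (x * 2 ^ suc i + y′) ≡ odd y′
  odd-x2^[1+i]+y′ = begin
    odd (x * (2 * 2 ^ i) + y′)  ≡⟨ cong (λ z → odd (z + y′)) (trans (cong (x *_) (*-comm 2 (2 ^ i))) (sym (*-assoc x (2 ^ i) 2))) ⟩
    odd (x * 2 ^ i * 2 + y′)    ≡⟨ odd-m*2+n (x * 2 ^ i) y′ ⟩
    odd y′                      ∎
  regroup : ∀ x P c y′ → x * (2 * P) + (c + y′ * 2) ≡ c + (x * P + y′) * 2
  regroup = solve-∀
  split-last-digit : x * 2 ^ suc (suc i) + y ≡ toℕ c + (x * 2 ^ suc i + y′) * 2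
  split-last-digit = trans (cong (x * 2 ^ suc (suc i) +_) (n≡odd+[n/2]*2 y)) (regroup x (2 ^ suc i) (toℕ c) y′)

rs-concat-low : ∀ i x y → y < 2 ^ i → rs (x * 2 ^ suc i + y) ≡ rs x xor rs y
rs-concat-low i x y y< = begin
  rs (x * 2 ^ suc i + y)                 ≡⟨ rs-concat i x y (<-≤-trans y< (^-monoʳ-≤ 2 (n≤1+n i))) ⟩
  (rs x xor rs y) xor (odd x ∧ bit i y)  ≡⟨ cong (λ c → (rs x xor rs y) xor (odd x ∧ c)) (bit-< i y y<) ⟩
  (rs x xor rs y) xor (odd x ∧ false)    ≡⟨ cong ((rs x xor rs y) xor_) (∧-zeroʳ (odd x)) ⟩
  (rs x xor rs y) xor false              ≡⟨ xor-identityʳ (rs x xor rs y) ⟩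
  rs x xor rs y                          ∎
  where open ≡-Reasoning

rs-concat-high : ∀ i x y → 2 ^ i ≤ y → y < 2 ^ suc i → rs (x * 2 ^ suc i + y) ≡ (rs x xor rs y) xor odd x
rs-concat-high i x y 2^i≤y y< = begin
  rs (x * 2 ^ suc i + y)                 ≡⟨ rs-concat i x y y< ⟩
  (rs x xor rs y) xor (odd x ∧ bit i y)  ≡⟨ cong (λ c → (rs x xor rs y) xor (odd x ∧ c)) (bit-≥ i y 2^i≤y y<) ⟩
  (rs x xor rs y) xor (odd x ∧ true)     ≡⟨ cong ((rs x xor rs y) xor_) (∧-identityʳ (odd x)) ⟩
  (rs x xor rs y) xor odd x              ∎
  where open ≡-Reasoning

δ : ℕ → Bool
δ n = rs n xor rs (suc n)

δ-even : ∀ t → δ (t * 2) ≡ odd t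
δ-even t = begin
  rs (t * 2) xor rs (1 + t * 2)          ≡⟨ cong₂ _xor_ (rs-b+m*2 false t) (rs-b+m*2 true t) ⟩
  (rs t xor false) xor (rs t xor odd t)  ≡⟨ solve 2 (λ a p → (a :+ con false) :+ (a :+ p) := p) refl (rs t) (odd t) ⟩
  odd t                                  ∎
  where open ≡-Reasoning
        open xor-∧-Solver

δ-odd : ∀ t → δ (1 + t * 2) ≡ odd t xor δ t
δ-odd t = begin
  rs (1 + t * 2) xor rs (0 + suc t * 2)        ≡⟨ cong₂ _xor_ (rs-b+m*2 true t) (rs-b+m*2 false (suc t)) ⟩
  (rs t xor odd t) xor (rs (suc t) xor false)  ≡⟨ solve 3 (λ a p b → (a :+ p) :+ (b :+ con false) := p :+ (a :+ b)) refl (rs t) (odd t) (rs (suc t)) ⟩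
  odd t xor δ t                                ∎
  where open ≡-Reasoning
        open xor-∧-Solver

δ-m*4 : ∀ m → δ (m * 4) ≡ false
δ-m*4 m = begin
  δ (m * 4)      ≡⟨ cong δ (*-assoc m 2 2) ⟨
  δ (m * 2 * 2)  ≡⟨ δ-even (m * 2) ⟩
  odd (m * 2)    ≡⟨ odd-m*2 m ⟩
  false          ∎
  where open ≡-Reasoning

δ-5+m*8 : ∀ m → δ (5 + m * 8) ≡ true
δ-5+m*8 m = begin
  δ (5 + m * 8)                                  ≡⟨ cong δ (regroup m) ⟩
  δ (1 + (1 + m * 2) * 2 * 2)                    ≡⟨ δ-odd ((1 + m * 2) * 2) ⟩
  odd ((1 + m * 2) * 2) xor δ ((1 + m * 2) * 2)  ≡⟨ cong₂ _xor_ (odd-m*2 (1 + m * 2)) (δ-even (1 + m * 2)) ⟩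
  odd (1 + m * 2)                                ≡⟨ odd-b+m*2 true m ⟩
  true                                           ∎
  where open ≡-Reasoning
        regroup : ∀ m → 5 + m * 8 ≡ 1 + (1 + m * 2) * 2 * 2
        regroup = solve-∀

δ-6+m*8 : ∀ m → δ (6 + m * 8) ≡ true
δ-6+m*8 m = begin
  δ (6 + m * 8)                  ≡⟨ cong δ (regroup m) ⟩
  δ ((1 + (1 + m * 2) * 2) * 2)  ≡⟨ δ-even (1 + (1 + m * 2) * 2) ⟩
  odd (1 + (1 + m * 2) * 2)      ≡⟨ odd-b+m*2 true (1 + m * 2) ⟩
  true                           ∎
  where open ≡-Reasoning
        regroup : ∀ m → 6 + m * 8 ≡ (1 + (1 + m * 2) * 2) * 2
        regroup = solve-∀

-- Going from 2^t - 1 to 2^t sets bit t of the lower word, which pairs with the odd U.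
δ-odd-multiple : ∀ t U j → odd U ≡ true → 2 ^ t ≡ suc j → δ (U * 2 ^ suc t + j) ≢ δ j
δ-odd-multiple t U j odd-U 2^t≡1+j δ≡ = not-x≢x (δ j) (begin
  not (δ j)
    ≡⟨ true-xor (δ j) ⟨
  true xor δ j
    ≡⟨ solve 3 (λ u a b → con true :+ (a :+ b) := (u :+ a) :+ ((u :+ b) :+ con true)) refl (rs U) (rs j) (rs (suc j)) ⟩
  (rs U xor rs j) xor ((rs U xor rs (suc j)) xor true)
    ≡⟨ cong₂ _xor_ (rs-concat-low t U j j<2^t) (trans (rs-concat-high t U (suc j) (≤-reflexive 2^t≡1+j) 1+j<2^[1+t]) (cong ((rs U xor rs (suc j)) xor_) odd-U)) ⟨
  rs (U * 2 ^ suc t + j) xor rs (U * 2 ^ suc t + suc j)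
    ≡⟨ cong (λ m → rs (U * 2 ^ suc t + j) xor rs m) (+-suc (U * 2 ^ suc t) j) ⟩
  δ (U * 2 ^ suc t + j)
    ≡⟨ δ≡ ⟩
  δ j ∎)
  where
  open ≡-Reasoning
  open xor-∧-Solver
  not-x≢x : ∀ x → not x ≢ x
  not-x≢x false ()
  not-x≢x true  ()
  j<2^t : j < 2 ^ t
  j<2^t = subst (j <_) (sym 2^t≡1+j) ≤-refl
  1+j<2^[1+t] : suc j < 2 ^ suc t
  1+j<2^[1+t] = subst (_< 2 ^ suc t) 2^t≡1+j (^-monoʳ-< 2 (s≤s (s≤s z≤n)) (n<1+n t))

-- Finite verification

-- e11 n runs on fuel n; a small fixed fuel keeps the exhaustive checks fast.
rsᶠ : ℕ → ℕ → Bool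
rsᶠ f z = odd (e11-fuel f z)

rs≡rsᶠ : ∀ f z → z < 2 ^ f → rs z ≡ rsᶠ f z
rs≡rsᶠ f z z< = cong odd (e11≡e11-fuel f z z<)

-- rs (U * 2 ^ (i + 1) + z) for z < 2 * 2 ^ (i + 1), in terms of z and
-- p = rs U, q = rs (U + 1), b = odd U.
rsModel : ℕ → Bool → Bool → Bool → ℕ → Bool
rsModel i p q b z =
  if z <ᵇ 2 ^ suc i
  then (p xor rsᶠ (suc i) z) xor (b ∧ bit i z)
  else (q xor rsᶠ (suc i) (z ∸ 2 ^ suc i)) xor (not b ∧ bit i (z ∸ 2 ^ suc i))

rs-model : ∀ i U z → z < 2 ^ suc i + 2 ^ suc i → rs (U * 2 ^ suc i + z) ≡ rsModel i (rs U) (rs (suc U)) (odd U) z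
rs-model i U z z<2P with z <ᵇ 2 ^ suc i in z<ᵇP
... | true = begin
  rs (U * 2 ^ suc i + z)                          ≡⟨ rs-concat i U z z<P ⟩
  (rs U xor rs z) xor (odd U ∧ bit i z)           ≡⟨ cong (λ t → (rs U xor t) xor (odd U ∧ bit i z)) (rs≡rsᶠ (suc i) z z<P) ⟩
  (rs U xor rsᶠ (suc i) z) xor (odd U ∧ bit i z)  ∎
  where open ≡-Reasoning
        z<P : z < 2 ^ suc i
        z<P = <ᵇ⇒< z (2 ^ suc i) (subst T (sym z<ᵇP) tt)
... | false = begin
  rs (U * P + z)                                   ≡⟨ cong (λ t → rs (U * P + t)) P+w≡z ⟨
  rs (U * P + (P + w))                             ≡⟨ cong rs (carry U P w) ⟩
  rs (suc U * P + w)                               ≡⟨ rs-concat i (suc U) w w<P ⟩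
  (rs (suc U) xor rs w) xor (odd (suc U) ∧ bit i w)
    ≡⟨ cong₂ (λ t o → (rs (suc U) xor t) xor (o ∧ bit i w)) (rs≡rsᶠ (suc i) w w<P) (odd-suc U) ⟩
  (rs (suc U) xor rsᶠ (suc i) w) xor (not (odd U) ∧ bit i w) ∎
  where
  open ≡-Reasoning
  P = 2 ^ suc i
  w = z ∸ P
  P+w≡z : P + w ≡ z
  P+w≡z = m+[n∸m]≡n {P} (≮⇒≥ λ z<P → subst T z<ᵇP (<⇒<ᵇ z<P))
  w<P : w < P
  w<P = +-cancelˡ-< P w P (subst (_< P + P) (sym P+w≡z) z<2P)
  carry : ∀ U P w → U * P + (P + w) ≡ suc U * P + w
  carry = solve-∀

∀-Bool? : {P : Bool → Set} → (∀ b → Dec (P b)) → Dec (∀ b → P b)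
∀-Bool? {P} P? = map′ both (λ ∀P → ∀P true , ∀P false) (P? true ×-dec P? false)
  where both : P true × P false → ∀ b → P b
        both (t , f) true  = t
        both (t , f) false = f

ModelFlipsWithin : ℕ → ℕ → ℕ → Bool → Bool → Bool → ℕ → Set
ModelFlipsWithin i d v p q b a = ∃ λ l → l < v × rsModel i p q b (a + suc l * d) ≢ rsModel i p q b a

ModelFlipsEverywhere : ℕ → ℕ → ℕ → Set
ModelFlipsEverywhere i d v = ∀ {a} → a < 2 ^ suc i → ∀ p q b → ModelFlipsWithin i d v p q b a

modelFlipsEverywhere? : ∀ i d v → Dec (ModelFlipsEverywhere i d v)
modelFlipsEverywhere? i d v =
  allUpTo? (λ a → ∀-Bool? λ p → ∀-Bool? λ q → ∀-Bool? λ b →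
              anyUpTo? (λ l → ¬? (rsModel i p q b (a + suc l * d) ≟ᵇ rsModel i p q b a)) v)
           (2 ^ suc i)

A≤-from-model : ∀ i d v → v * d ≤ 2 ^ suc i → ModelFlipsEverywhere i d v → ∀ n → A≤ n d v
A≤-from-model i d v vd≤P flips n = suc l , s≤s z≤n , l<v , rs≢⇒r≢ (n + suc l * d) n rs≢
  where
  P = 2 ^ suc i
  instance P≢0 : NonZero P
  P≢0 = m^n≢0 2 (suc i)
  a = n % P
  U = n / P
  a<P = m%n<n n P
  n+c≡ : ∀ c → n + c ≡ U * P + (a + c)
  n+c≡ c = trans (cong (_+ c) (m≡m%n+[m/n]*n n P)) (regroup a (U * P) c)
    where regroup : ∀ a b c → a + b + c ≡ b + (a + c)
          regroup = solve-∀
  in-range : ∀ c → c ≤ P → a + c < P + P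
  in-range c c≤P = +-mono-<-≤ a<P c≤P
  flip = flips a<P (rs U) (rs (suc U)) (odd U)
  l = proj₁ flip
  l<v = proj₁ (proj₂ flip)
  model≢ = proj₂ (proj₂ flip)
  rs≢ : rs (n + suc l * d) ≢ rs n
  rs≢ rs≡ = model≢ (begin
    rsModel i (rs U) (rs (suc U)) (odd U) (a + suc l * d)  ≡⟨ rs-model i U _ (in-range _ (≤-trans (*-monoˡ-≤ d l<v) vd≤P)) ⟨
    rs (U * P + (a + suc l * d))                          ≡⟨ cong rs (n+c≡ (suc l * d)) ⟨
    rs (n + suc l * d)                                    ≡⟨ rs≡ ⟩
    rs n                                                  ≡⟨ cong rs (trans (sym (+-identityʳ n)) (n+c≡ 0)) ⟩
    rs (U * P + (a + 0))                                  ≡⟨ rs-model i U _ (in-range 0 z≤n) ⟩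
    rsModel i (rs U) (rs (suc U)) (odd U) (a + 0)         ≡⟨ cong (rsModel i (rs U) (rs (suc U)) (odd U)) (+-identityʳ a) ⟩
    rsModel i (rs U) (rs (suc U)) (odd U) a               ∎)
    where open ≡-Reasoning

A≤-by-search : ∀ i d v {vd≤P : True (v * d ≤? 2 ^ suc i)} {flips : True (modelFlipsEverywhere? i d v)} → ∀ n → A≤ n d v
A≤-by-search i d v {vd≤P} {flips} = A≤-from-model i d v (toWitness vd≤P) (toWitness flips)

A≥-pointwise? : ∀ n d v → Dec (∀ {l} → l < v → 1 ≤ l → r (n + l * d) ≡ r n)
A≥-pointwise? n d v = allUpTo? (λ l → (1 ≤? l) →-dec (r (n + l * d) ≟ r n)) v

A≥-by-search : ∀ n d v {constant : True (A≥-pointwise? n d v)} → A≥ n d v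
A≥-by-search n d v {constant} l 1≤l l<v = toWitness constant l<v 1≤l

rsModel-shift : ∀ i p q b z → rsModel i p q b z ≡ p xor rsModel i false (p xor q) b z
rsModel-shift i p q b z with z <ᵇ 2 ^ suc i
... | true  = solve 3 (λ p x y → (p :+ x) :+ y := p :+ (x :+ y)) refl p _ _
  where open xor-∧-Solver
... | false = solve 4 (λ p q x y → (q :+ x) :+ y := p :+ ((p :+ q) :+ x :+ y)) refl p q _ _
  where open xor-∧-Solver

-- δ (U * 16 + z) for z < 31, in terms of z and c = δ U, b = odd U.
δModel : Bool → Bool → ℕ → Bool
δModel c b z = rsModel 3 false c b z xor rsModel 3 false c b (suc z)

δ-model : ∀ U z → z < 31 → δ (U * 16 + z) ≡ δModel (δ U) (odd U) z
δ-model U z z<31 = begin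
  rs (U * 16 + z) xor rs (suc (U * 16 + z))
    ≡⟨ cong (λ t → rs (U * 16 + z) xor rs t) (+-suc (U * 16) z) ⟨
  rs (U * 16 + z) xor rs (U * 16 + suc z)
    ≡⟨ cong₂ _xor_ (rs-model 3 U z (<-trans z<31 (n<1+n 31))) (rs-model 3 U (suc z) (s≤s z<31)) ⟩
  model z xor model (suc z)
    ≡⟨ cong₂ _xor_ (rsModel-shift 3 (rs U) (rs (suc U)) (odd U) z) (rsModel-shift 3 (rs U) (rs (suc U)) (odd U) (suc z)) ⟩
  (rs U xor rsModel 3 false (δ U) (odd U) z) xor (rs U xor rsModel 3 false (δ U) (odd U) (suc z))
    ≡⟨ solve 3 (λ p x y → (p :+ x) :+ (p :+ y) := x :+ y) refl (rs U) _ _ ⟩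
  δModel (δ U) (odd U) z ∎
  where open ≡-Reasoning
        open xor-∧-Solver
        model : ℕ → Bool
        model = rsModel 3 (rs U) (rs (suc U)) (odd U)

RelatedWithin : (Bool → Bool → Set) → ℕ → (ℕ → Bool) → (ℕ → Bool) → Set
RelatedWithin R W f g = ∃ λ j → j < W × R (f j) (g j)

ModelWindows : (Bool → Bool → Set) → ℕ → (ℕ → ℕ → Set) → Set
ModelWindows R W C = ∀ {a} → a < 16 → ∀ {b} → b < 16 → C a b → ∀ c e c′ e′ →
  RelatedWithin R W (λ j → δModel c e (a + j)) (λ j → δModel c′ e′ (b + j))

modelWindows? : ∀ {R : Bool → Bool → Set} {C : ℕ → ℕ → Set} →
                (∀ x y → Dec (R x y)) → ∀ W → (∀ a b → Dec (C a b)) → Dec (ModelWindows R W C)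
modelWindows? R? W C? =
  allUpTo? (λ a → allUpTo? (λ b → C? a b →-dec
    ∀-Bool? λ c → ∀-Bool? λ e → ∀-Bool? λ c′ → ∀-Bool? λ e′ →
      anyUpTo? (λ j → R? (δModel c e (a + j)) (δModel c′ e′ (b + j))) W) 16) 16

δ-windows : ∀ {R : Bool → Bool → Set} {C : ℕ → ℕ → Set} (R? : ∀ x y → Dec (R x y)) (C? : ∀ a b → Dec (C a b)) W →
            W ≤ 15 → {found : True (modelWindows? R? W C?)} →
            ∀ u v → C (u % 16) (v % 16) → RelatedWithin R W (λ j → δ (u + j)) (λ j → δ (v + j))
δ-windows {R} R? C? W W≤15 {found} u v c = j , j<W , subst₂ R (sym (δ-window u)) (sym (δ-window v)) related
  where
  window = toWitness found (m%n<n u 16) (m%n<n v 16) c (δ (u / 16)) (odd (u / 16)) (δ (v / 16)) (odd (v / 16))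
  j = proj₁ window
  j<W = proj₁ (proj₂ window)
  related = proj₂ (proj₂ window)
  δ-window : ∀ u → δ (u + j) ≡ δModel (δ (u / 16)) (odd (u / 16)) (u % 16 + j)
  δ-window u = begin
    δ (u + j)                        ≡⟨ cong (λ t → δ (t + j)) (m≡m%n+[m/n]*n u 16) ⟩
    δ (u % 16 + u / 16 * 16 + j)     ≡⟨ cong δ (regroup (u % 16) (u / 16 * 16) j) ⟩
    δ (u / 16 * 16 + (u % 16 + j))   ≡⟨ δ-model (u / 16) (u % 16 + j) (+-mono-≤ (m%n<n u 16) (≤-trans (<⇒≤ j<W) W≤15)) ⟩
    δModel (δ (u / 16)) (odd (u / 16)) (u % 16 + j) ∎
    where open ≡-Reasoning
          regroup : ∀ a b c → a + b + c ≡ b + (a + c)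
          regroup = solve-∀

_≢?ᵇ_ : ∀ x y → Dec (x ≢ y)
x ≢?ᵇ y = ¬? (x ≟ᵇ y)

m%16%4≡m%4 : ∀ m → m % 16 % 4 ≡ m % 4
m%16%4≡m%4 m = m∣n⇒o%n%m≡o%m 4 16 m (divides 4 refl)

δ-agree-14 : ∀ u v → RelatedWithin _≡_ 14 (λ j → δ (u + j)) (λ j → δ (v + j))
δ-agree-14 u v = δ-windows _≟ᵇ_ (λ _ _ → yes tt) 14 (n≤1+n 14) u v tt

δ-agree-2 : ∀ u v → u % 4 ≡ v % 4 → RelatedWithin _≡_ 2 (λ j → δ (u + j)) (λ j → δ (v + j))
δ-agree-2 u v u≡v = δ-windows _≟ᵇ_ (λ a b → a % 4 ≟ b % 4) 2 (s≤s (s≤s z≤n)) u v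
                      (trans (m%16%4≡m%4 u) (trans u≡v (sym (m%16%4≡m%4 v))))

δ-disagree-7 : ∀ u v → u % 4 ≢ v % 4 → RelatedWithin _≢_ 7 (λ j → δ (u + j)) (λ j → δ (v + j))
δ-disagree-7 u v u≢v = δ-windows _≢?ᵇ_ (λ a b → ¬? (a % 4 ≟ b % 4)) 7 (+-monoʳ-≤ 7 z≤n) u v
                         (λ eq → u≢v (trans (sym (m%16%4≡m%4 u)) (trans eq (m%16%4≡m%4 v))))

-- The upper bound for k ≥ 6

xor≡false⇒≡ : ∀ x y → x xor y ≡ false → x ≡ y
xor≡false⇒≡ false false _ = refl
xor≡false⇒≡ true  true  _ = refl

≡⇒xor≡false : ∀ {x y} → x ≡ y → x xor y ≡ false
≡⇒xor≡false {x} refl = xor-same x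

A≤-from-change : ∀ n d v l → l < v → rs (n + l * d) ≢ rs (n + suc l * d) → A≤ n d v
A≤-from-change n d v l l<v change with rs (n + l * d) ≟ᵇ rs n
... | yes same = suc l , s≤s z≤n , l<v , rs≢⇒r≢ (n + suc l * d) n (λ moved → change (trans same (sym moved)))
A≤-from-change n d v zero    l<v change | no moved = ⊥-elim (moved (cong rs (+-identityʳ n)))
A≤-from-change n d v (suc l) l<v change | no moved = suc l , s≤s z≤n , <⇒≤ l<v , rs≢⇒r≢ (n + suc l * d) n moved

-- Here k = h + 1 with h = 5 + e, and a K + b is read as the pair (a , b).
module UpperBound (e : ℕ) where

  h H K d L : ℕ
  h = 5 + e
  H = 2 ^ h
  K = 2 ^ suc h
  d = K + 1
  L = H + 2

  32≤H : 32 ≤ H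
  32≤H = ^-monoʳ-≤ 2 (m≤m+n 5 e)

  K≡H+H : K ≡ H + H
  K≡H+H = cong (H +_) (+-identityʳ H)

  H+c<K : ∀ {c} → c < H → H + c < K
  H+c<K {c} c<H = subst (H + c <_) (sym K≡H+H) (+-monoʳ-< H c<H)

  c≤L : ∀ {c} → c ≤ 34 → c ≤ L
  c≤L c≤34 = ≤-trans c≤34 (+-monoˡ-≤ 2 32≤H)

  c<H : ∀ {c} → c < 32 → c < H
  c<H c<32 = <-≤-trans c<32 32≤H

  pos : ℕ → ℕ → ℕ
  pos a b = a * K + b

  pos-+ : ∀ a b j → pos a b + j * d ≡ pos (a + j) (b + j)
  pos-+ a b j = shift a b j K
    where shift : ∀ a b j K → a * K + b + j * (K + 1) ≡ (a + j) * K + (b + j)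
          shift = solve-∀

  pos-wrap : ∀ a b c → b + c ≡ K → pos a b + c * d ≡ pos (suc (a + c)) 0
  pos-wrap a b c b+c≡K = subst (λ K → a * K + b + c * (K + 1) ≡ suc (a + c) * K + 0) b+c≡K (carry a b c)
    where carry : ∀ a b c → a * (b + c) + b + c * ((b + c) + 1) ≡ suc (a + c) * (b + c) + 0
          carry = solve-∀

  rs-step-low : ∀ a b → suc b < H → rs (pos a b) xor rs (pos (suc a) (suc b)) ≡ δ a xor δ b
  rs-step-low a b 1+b<H = begin
    rs (pos a b) xor rs (pos (suc a) (suc b))
      ≡⟨ cong₂ _xor_ (rs-concat-low h a b (<-trans (n<1+n b) 1+b<H)) (rs-concat-low h (suc a) (suc b) 1+b<H) ⟩
    (rs a xor rs b) xor (rs (suc a) xor rs (suc b))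
      ≡⟨ solve 4 (λ a b a′ b′ → (a :+ b) :+ (a′ :+ b′) := (a :+ a′) :+ (b :+ b′)) refl (rs a) (rs b) (rs (suc a)) (rs (suc b)) ⟩
    δ a xor δ b ∎
    where open ≡-Reasoning
          open xor-∧-Solver

  rs-step-high : ∀ a b → H ≤ b → suc b < K → rs (pos a b) xor rs (pos (suc a) (suc b)) ≡ not (δ a xor δ b)
  rs-step-high a b H≤b 1+b<K = begin
    rs (pos a b) xor rs (pos (suc a) (suc b))
      ≡⟨ cong₂ _xor_ (rs-concat-high h a b H≤b (<-trans (n<1+n b) 1+b<K)) (rs-concat-high h (suc a) (suc b) (m≤n⇒m≤1+n H≤b) 1+b<K) ⟩
    ((rs a xor rs b) xor odd a) xor ((rs (suc a) xor rs (suc b)) xor odd (suc a))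
      ≡⟨ cong (λ o → ((rs a xor rs b) xor odd a) xor ((rs (suc a) xor rs (suc b)) xor o)) (trans (odd-suc a) (sym (true-xor (odd a)))) ⟩
    ((rs a xor rs b) xor odd a) xor ((rs (suc a) xor rs (suc b)) xor (true xor odd a))
      ≡⟨ solve 5 (λ a b a′ b′ o → ((a :+ b) :+ o) :+ ((a′ :+ b′) :+ (con true :+ o)) := con true :+ ((a :+ a′) :+ (b :+ b′)))
               refl (rs a) (rs b) (rs (suc a)) (rs (suc b)) (odd a) ⟩
    true xor (δ a xor δ b)
      ≡⟨ true-xor (δ a xor δ b) ⟩
    not (δ a xor δ b) ∎
    where open ≡-Reasoning
          open xor-∧-Solver

  ChangeAt : ℕ → ℕ → Set
  ChangeAt n l = rs (n + l * d) ≢ rs (n + suc l * d)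

  record ChangeBefore (n : ℕ) : Set where
    constructor change-at
    field
      step   : ℕ
      step<L : step < L
      change : ChangeAt n step

  along : ∀ n l u v → n + l * d ≡ pos u v → ∀ j → n + (l + j) * d ≡ pos (u + j) (v + j)
  along n l u v n+ld≡ j = begin
    n + (l + j) * d      ≡⟨ distribute n l j d ⟩
    n + l * d + j * d    ≡⟨ cong (_+ j * d) n+ld≡ ⟩
    pos u v + j * d      ≡⟨ pos-+ u v j ⟩
    pos (u + j) (v + j)  ∎
    where open ≡-Reasoning
          distribute : ∀ n l j d → n + (l + j) * d ≡ n + l * d + j * d
          distribute = solve-∀

  rs-change : ∀ n l u v → n + l * d ≡ pos u v → rs (pos u v) ≢ rs (pos (suc u) (suc v)) → ChangeAt n l
  rs-change n l u v n+ld≡ rs≢ rs≡ = rs≢ (begin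
    rs (pos u v)              ≡⟨ cong rs n+ld≡ ⟨
    rs (n + l * d)            ≡⟨ rs≡ ⟩
    rs (n + suc l * d)        ≡⟨ cong rs (cong (λ m → n + m * d) (+-comm 1 l)) ⟩
    rs (n + (l + 1) * d)      ≡⟨ cong rs (along n l u v n+ld≡ 1) ⟩
    rs (pos (u + 1) (v + 1))  ≡⟨ cong₂ (λ a b → rs (pos a b)) (+-comm u 1) (+-comm v 1) ⟩
    rs (pos (suc u) (suc v))  ∎)
    where open ≡-Reasoning

  change-within : ∀ {n} l u v W {R : Bool → Bool → Set} → n + l * d ≡ pos u v → l + W ≤ L →
                  (∀ {j} → j < W → R (δ (u + j)) (δ (v + j)) → rs (pos (u + j) (v + j)) ≢ rs (pos (suc (u + j)) (suc (v + j)))) →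
                  RelatedWithin R W (λ j → δ (u + j)) (λ j → δ (v + j)) → ChangeBefore n
  change-within {n} l u v W n+ld≡ l+W≤L step (j , j<W , related) =
    change-at (l + j) (<-≤-trans (+-monoʳ-< l j<W) l+W≤L) (rs-change n (l + j) (u + j) (v + j) (along n l u v n+ld≡ j) (step j<W related))

  change-low : ∀ {n} l u v W → n + l * d ≡ pos u v → l + W ≤ L → v + W < H →
               RelatedWithin _≢_ W (λ j → δ (u + j)) (λ j → δ (v + j)) → ChangeBefore n
  change-low l u v W n+ld≡ l+W≤L v+W<H = change-within l u v W {_≢_} n+ld≡ l+W≤L step
    where
    step : ∀ {j} → j < W → δ (u + j) ≢ δ (v + j) → rs (pos (u + j) (v + j)) ≢ rs (pos (suc (u + j)) (suc (v + j)))
    step {j} j<W δ≢ rs≡ = δ≢ (xor≡false⇒≡ _ _ (begin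
      δ (u + j) xor δ (v + j)
        ≡⟨ rs-step-low (u + j) (v + j) (≤-trans (s≤s (+-monoʳ-< v j<W)) v+W<H) ⟨
      rs (pos (u + j) (v + j)) xor rs (pos (suc (u + j)) (suc (v + j)))
        ≡⟨ ≡⇒xor≡false rs≡ ⟩
      false ∎))
      where open ≡-Reasoning

  change-high : ∀ {n} l u v W → n + l * d ≡ pos u v → l + W ≤ L → H ≤ v → v + W < K →
                RelatedWithin _≡_ W (λ j → δ (u + j)) (λ j → δ (v + j)) → ChangeBefore n
  change-high l u v W n+ld≡ l+W≤L H≤v v+W<K = change-within l u v W {_≡_} n+ld≡ l+W≤L step
    where
    step : ∀ {j} → j < W → δ (u + j) ≡ δ (v + j) → rs (pos (u + j) (v + j)) ≢ rs (pos (suc (u + j)) (suc (v + j)))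
    step {j} j<W δ≡ rs≡ = true≢false (begin
      true
        ≡⟨ cong not (xor-same (δ (v + j))) ⟨
      not (δ (v + j) xor δ (v + j))
        ≡⟨ cong (λ b → not (b xor δ (v + j))) δ≡ ⟨
      not (δ (u + j) xor δ (v + j))
        ≡⟨ rs-step-high (u + j) (v + j) (≤-trans H≤v (m≤m+n v j)) (≤-trans (s≤s (+-monoʳ-< v j<W)) v+W<K) ⟨
      rs (pos (u + j) (v + j)) xor rs (pos (suc (u + j)) (suc (v + j)))
        ≡⟨ ≡⇒xor≡false rs≡ ⟩
      false ∎)
      where open ≡-Reasoning
            true≢false : true ≢ false
            true≢false ()

  change-via-H : ∀ x y l₀ W → y + l₀ ≡ H → l₀ + W ≤ L → W < H →
                 RelatedWithin _≡_ W (λ j → δ (x + l₀ + j)) (λ j → δ (y + l₀ + j)) → ChangeBefore (pos x y)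
  change-via-H x y l₀ W y+l₀≡H l₀+W≤L W<H =
    change-high l₀ (x + l₀) (y + l₀) W (pos-+ x y l₀) l₀+W≤L (≤-reflexive (sym y+l₀≡H))
                (subst (λ v → v + W < K) (sym y+l₀≡H) (H+c<K W<H))

  change-from-low : ∀ x y → y < H → ChangeBefore (pos x y)
  change-from-low x y y<H with m≤n⇒∃[o]m+o≡n (<⇒≤ y<H)
  ... | l₀ , y+l₀≡H with x % 4 ≟ y % 4 | y + 8 ≤? H
  ... | yes x≡y | _ =
    change-via-H x y l₀ 2 y+l₀≡H (+-monoˡ-≤ 2 (subst (l₀ ≤_) y+l₀≡H (m≤n+m l₀ y))) (c<H (s≤s (s≤s (s≤s z≤n))))
                 (δ-agree-2 (x + l₀) (y + l₀) (%-cong-+ʳ x y l₀ x≡y))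
  ... | no x≢y | yes y+8≤H =
    change-low 0 x y 7 (+-identityʳ (pos x y)) (c≤L (+-monoʳ-≤ 7 z≤n)) (subst (_≤ H) (+-suc y 7) y+8≤H) (δ-disagree-7 x y x≢y)
  ... | no _ | no y+8≰H =
    change-via-H x y l₀ 14 y+l₀≡H l₀+14≤L (c<H (+-monoʳ-≤ 15 z≤n)) (δ-agree-14 (x + l₀) (y + l₀))
    where l₀<8 : l₀ < 8
          l₀<8 = ≰⇒> (λ 8≤l₀ → y+8≰H (subst (y + 8 ≤_) y+l₀≡H (+-monoʳ-≤ y 8≤l₀)))
          l₀+14≤L : l₀ + 14 ≤ L
          l₀+14≤L = c≤L (≤-trans (+-monoˡ-≤ 14 (≤-pred l₀<8)) (+-monoʳ-≤ 21 z≤n))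

  -- The wrap lands on (X , 0); below H the walk then flips unless H ∣ X.
  change-after-wrap : ∀ {n} c s U → c ≤ 14 → s < h → odd U ≡ true → n + c * d ≡ pos (U * 2 ^ s) 0 → ChangeBefore n
  change-after-wrap c zero U c≤14 _ odd-U n+cd≡ =
    change-low c (U * 1) 0 7 n+cd≡ (c≤L (≤-trans (+-monoˡ-≤ 7 c≤14) (+-monoʳ-≤ 21 z≤n))) (c<H (+-monoʳ-≤ 8 z≤n))
               (δ-disagree-7 (U * 1) 0 (odd⇒%4≢0 (U * 1) (trans (cong odd (*-identityʳ U)) odd-U)))
  change-after-wrap c (suc t) U c≤14 1+t<h odd-U n+cd≡ with m≤n⇒∃[o]m+o≡n (m^n>0 2 t)
  ... | j , 1+j≡2^t =
    change-low c (U * 2 ^ suc t) 0 (suc j) n+cd≡ c+2^t≤L 2^t<H (j , ≤-refl , δ-odd-multiple t U j odd-U (sym 1+j≡2^t))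
    where
    G = 2 ^ (4 + e)
    2^t≤G : suc j ≤ G
    2^t≤G = subst (_≤ G) (sym 1+j≡2^t) (^-monoʳ-≤ 2 (≤-trans (n≤1+n t) (≤-pred 1+t<h)))
    2^t<H : suc j < H
    2^t<H = subst (_< H) (sym 1+j≡2^t) (^-monoʳ-< 2 (s≤s (s≤s z≤n)) (<-trans (n<1+n t) 1+t<h))
    c+2^t≤L : c + suc j ≤ L
    c+2^t≤L = begin
      c + suc j  ≤⟨ +-mono-≤ c≤14 2^t≤G ⟩
      14 + G     ≤⟨ +-monoˡ-≤ G (≤-trans (+-monoʳ-≤ 14 z≤n) (+-monoˡ-≤ 2 (^-monoʳ-≤ 2 (m≤m+n 4 e)))) ⟩
      G + 2 + G  ≡⟨ regroup G ⟩
      L          ∎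
      where open ≤-Reasoning
            regroup : ∀ G → G + 2 + G ≡ 2 * G + 2
            regroup = solve-∀

  δ-m*H : ∀ m → δ (m * H) ≡ false
  δ-m*H m = trans (cong δ (H≡F*4 m (2 ^ (3 + e)))) (δ-m*4 (m * 2 ^ (3 + e)))
    where H≡F*4 : ∀ m F → m * (2 * (2 * F)) ≡ m * F * 4
          H≡F*4 = solve-∀

  -- From y = K - 1 with H ∣ X: the step H + 1 → H + 2 in the upper half.
  change-across-wrap : ∀ {n} X → n + 1 * d ≡ pos (X * H) 0 → ChangeBefore n
  change-across-wrap {n} X n+d≡ =
    change-high (1 + H) (X * H + H) (0 + H) 1 (along n 1 (X * H) 0 n+d≡ H) (≤-reflexive (regroup H))
                ≤-refl (H+c<K (c<H (s≤s (s≤s z≤n))))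
                (0 , s≤s z≤n , (begin
                  δ (X * H + H + 0)  ≡⟨ cong δ (next-multiple X H) ⟩
                  δ (suc X * H)      ≡⟨ δ-m*H (suc X) ⟩
                  false              ≡⟨ δ-m*H 1 ⟨
                  δ (1 * H)          ≡⟨ cong δ (next-multiple 0 H) ⟨
                  δ (0 + H + 0)      ∎))
    where open ≡-Reasoning
          next-multiple : ∀ X H → X * H + H + 0 ≡ suc X * H
          next-multiple = solve-∀
          regroup : ∀ H → 1 + H + 1 ≡ H + 2
          regroup = solve-∀

  -- From y = K - c - 2 with H ∣ X: the step c → c + 1, two steps before the wrap.
  change-before-wrap : ∀ x y c X → H ≤ y → y + suc (suc c) ≡ K → suc (x + suc (suc c)) ≡ suc X * H → c ≤ 12 →
                       ChangeBefore (pos x y)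
  change-before-wrap x y c X H≤y y+c+2≡K X₁≡ c≤12 with m≤n⇒∃[o]m+o≡n (m^n>0 2 (2 + e))
  ... | Q′ , 1+Q′≡Q =
    change-high c (x + c) (y + c) 1 (pos-+ x y c) (c≤L (≤-trans (+-monoˡ-≤ 1 c≤12) (+-monoʳ-≤ 13 z≤n)))
                (≤-trans H≤y (m≤m+n y c)) (≤-reflexive (trans (regroup y c) y+c+2≡K))
                (0 , s≤s z≤n , trans (trans (cong δ x+c≡) (δ-5+m*8 (X * suc Q′ + Q′))) (sym (trans (cong δ y+c≡) (δ-6+m*8 (1 + Q′ * 2)))))
    where
    open ≡-Reasoning
    Q = 2 ^ (2 + e)
    regroup : ∀ y c → suc (y + c + 1) ≡ y + suc (suc c)
    regroup = solve-∀
    x+c≡ : x + c + 0 ≡ 5 + (X * suc Q′ + Q′) * 8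
    x+c≡ = +-cancelˡ-≡ 3 _ _ (begin
      3 + (x + c + 0)                   ≡⟨ add-3 x c ⟩
      suc (x + suc (suc c))             ≡⟨ X₁≡ ⟩
      suc X * (2 * (2 * (2 * Q)))       ≡⟨ cong (λ q → suc X * (2 * (2 * (2 * q)))) 1+Q′≡Q ⟨
      suc X * (2 * (2 * (2 * suc Q′)))  ≡⟨ expand X Q′ ⟩
      3 + (5 + (X * suc Q′ + Q′) * 8)   ∎)
      where add-3 : ∀ x c → 3 + (x + c + 0) ≡ suc (x + suc (suc c))
            add-3 = solve-∀
            expand : ∀ X Q′ → suc X * (2 * (2 * (2 * suc Q′))) ≡ 3 + (5 + (X * suc Q′ + Q′) * 8)
            expand = solve-∀
    y+c≡ : y + c + 0 ≡ 6 + (1 + Q′ * 2) * 8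
    y+c≡ = +-cancelˡ-≡ 2 _ _ (begin
      2 + (y + c + 0)               ≡⟨ add-2 y c ⟩
      y + suc (suc c)               ≡⟨ y+c+2≡K ⟩
      2 * (2 * (2 * (2 * Q)))       ≡⟨ cong (λ q → 2 * (2 * (2 * (2 * q)))) 1+Q′≡Q ⟨
      2 * (2 * (2 * (2 * suc Q′)))  ≡⟨ expand Q′ ⟩
      2 + (6 + (1 + Q′ * 2) * 8)    ∎)
      where add-2 : ∀ y c → 2 + (y + c + 0) ≡ y + suc (suc c)
            add-2 = solve-∀
            expand : ∀ Q′ → 2 * (2 * (2 * (2 * suc Q′))) ≡ 2 + (6 + (1 + Q′ * 2) * 8)
            expand = solve-∀

  change-when-H∣X₁ : ∀ x y c X → H ≤ y → y + suc c ≡ K → suc (x + suc c) ≡ X * H → c < 14 → ChangeBefore (pos x y)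
  change-when-H∣X₁ x y zero    X       H≤y y+1≡K X₁≡ _ =
    change-across-wrap X (trans (pos-wrap x y 1 y+1≡K) (cong (λ a → pos a 0) X₁≡))
  change-when-H∣X₁ x y (suc c) zero    H≤y _ () _
  change-when-H∣X₁ x y (suc c) (suc X) H≤y y+c≡K X₁≡ c<14 =
    change-before-wrap x y c X H≤y y+c≡K X₁≡ (≤-pred (≤-pred c<14))

  change-near-wrap : ∀ x y c → H ≤ y → y + suc c ≡ K → c < 14 → ChangeBefore (pos x y)
  change-near-wrap x y c H≤y y+c≡K c<14 with 2^t∣⊎odd*2^s h (suc (x + suc c))
  ... | inj₂ (s , U , s<h , odd-U , X₁≡) =
    change-after-wrap (suc c) s U c<14 s<h odd-U (trans (pos-wrap x y (suc c) y+c≡K) (cong (λ a → pos a 0) X₁≡))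
  ... | inj₁ (divides X X₁≡) = change-when-H∣X₁ x y c X H≤y y+c≡K X₁≡ c<14

  change-from-high : ∀ x y → H ≤ y → y < K → ChangeBefore (pos x y)
  change-from-high x y H≤y y<K with y + 15 ≤? K
  ... | yes y+15≤K =
    change-high 0 x y 14 (+-identityʳ (pos x y)) (c≤L (+-monoʳ-≤ 14 z≤n)) H≤y (subst (_≤ K) (+-suc y 14) y+15≤K) (δ-agree-14 x y)
  ... | no y+15≰K with m≤n⇒∃[o]m+o≡n y<K
  ...   | c , 1+y+c≡K = change-near-wrap x y c H≤y (trans (+-suc y c) 1+y+c≡K) c<14
    where c<14 : c < 14
          c<14 = ≰⇒> (λ 14≤c → y+15≰K (subst (y + 15 ≤_) (trans (+-suc y c) 1+y+c≡K) (+-monoʳ-≤ y (s≤s 14≤c))))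

  change-everywhere : ∀ n → ChangeBefore n
  change-everywhere n = subst ChangeBefore (sym n≡pos) (by-last-digit (n % K <? H))
    where
    instance K≢0 : NonZero K
    K≢0 = m^n≢0 2 (suc h)
    n≡pos : n ≡ pos (n / K) (n % K)
    n≡pos = trans (m≡m%n+[m/n]*n n K) (+-comm (n % K) (n / K * K))
    by-last-digit : Dec (n % K < H) → ChangeBefore (pos (n / K) (n % K))
    by-last-digit (yes y<H) = change-from-low (n / K) (n % K) y<H
    by-last-digit (no y≮H)  = change-from-high (n / K) (n % K) (≮⇒≥ y≮H) (m%n<n n K)

  upper : ∀ n → A≤ n d L
  upper n = A≤-from-change n d L step step<L change
    where open ChangeBefore (change-everywhere n)

-- The lower bound

-- The witness (2K - 1) K + (K - 1) is the j = -1 member of the family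
-- (2K + j) K + j, on which rs is constant for 0 ≤ j ≤ H.
module LowerBound (h : ℕ) where

  H K : ℕ
  H = 2 ^ suc h
  K = 2 ^ suc (suc h)

  H<K : H < K
  H<K = ^-monoʳ-< 2 (s≤s (s≤s z≤n)) (n<1+n (suc h))

  rs-2K+y : ∀ y → y < K → rs (2 * K + y) ≡ rs y
  rs-2K+y y y<K = trans (rs-concat (suc h) 2 y y<K) (xor-identityʳ (rs y))

  rs-family : ∀ j → j ≤ H → rs ((2 * K + j) * K + j) ≡ false
  rs-family j j≤H with m≤n⇒m<n∨m≡n j≤H
  ... | inj₁ j<H = begin
    rs ((2 * K + j) * K + j)  ≡⟨ rs-concat-low (suc h) (2 * K + j) j j<H ⟩
    rs (2 * K + j) xor rs j   ≡⟨ cong (_xor rs j) (rs-2K+y j (<-trans j<H H<K)) ⟩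
    rs j xor rs j             ≡⟨ xor-same (rs j) ⟩
    false                     ∎
    where open ≡-Reasoning
  ... | inj₂ refl = begin
    rs ((2 * K + H) * K + H)                       ≡⟨ rs-concat-high (suc h) (2 * K + H) H ≤-refl H<K ⟩
    (rs (2 * K + H) xor rs H) xor odd (2 * K + H)  ≡⟨ cong₂ (λ a b → (a xor rs H) xor b) (rs-2K+y H H<K) odd-2K+H ⟩
    (rs H xor rs H) xor false                      ≡⟨ cong (_xor false) (xor-same (rs H)) ⟩
    false                                          ∎
    where open ≡-Reasoning
          odd-2K+H : odd (2 * K + H) ≡ false
          odd-2K+H = trans (odd-+ (2 * K) H) (cong₂ _xor_ (odd-2*m K) (odd-2*m (2 ^ h)))

  lower : ∃ λ n → A≥ n (K + 1) (H + 2)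
  lower with m≤n⇒∃[o]m+o≡n (m^n>0 2 (suc (suc h)))
  ... | o , 1+o≡K = n₀ , constant
    where
    n₀ = o * 2 * K + o
    rs-n₀ : rs n₀ ≡ false
    rs-n₀ = begin
      rs (o * 2 * K + o)
        ≡⟨ rs-concat (suc h) (o * 2) o (subst (o <_) 1+o≡K ≤-refl) ⟩
      (rs (o * 2) xor rs o) xor (odd (o * 2) ∧ bit (suc h) o)
        ≡⟨ cong₂ (λ a b → (a xor rs o) xor (b ∧ bit (suc h) o)) (trans (rs-b+m*2 false o) (xor-identityʳ (rs o))) (odd-m*2 o) ⟩
      (rs o xor rs o) xor false
        ≡⟨ cong (_xor false) (xor-same (rs o)) ⟩
      false ∎
      where open ≡-Reasoning
    n₀+[1+j]d≡ : ∀ j → n₀ + suc j * (K + 1) ≡ (2 * K + j) * K + j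
    n₀+[1+j]d≡ j = subst (λ K → o * 2 * K + o + suc j * (K + 1) ≡ (2 * K + j) * K + j) 1+o≡K (expand o j)
      where expand : ∀ o j → o * 2 * (1 + o) + o + suc j * ((1 + o) + 1) ≡ (2 * (1 + o) + j) * (1 + o) + j
            expand = solve-∀
    constant : A≥ n₀ (K + 1) (H + 2)
    constant (suc j) _ 1+j<H+2 =
      rs≡⇒r≡ (n₀ + suc j * (K + 1)) n₀ (trans (cong rs (n₀+[1+j]d≡ j)) (trans (rs-family j j≤H) (sym rs-n₀)))
      where j≤H : j ≤ H
            j≤H = ≤-pred (≤-pred (subst (suc (suc j) ≤_) (+-comm H 2) 1+j<H+2))

A≡-k≥4 : ∀ k → 4 ≤ k → A≡ (2 ^ k + 1) (2 ^ (k ∸ 1) + 2)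
A≡-k≥4 1 (s≤s ())
A≡-k≥4 2 (s≤s (s≤s ()))
A≡-k≥4 3 (s≤s (s≤s (s≤s ())))
A≡-k≥4 4 _ = A≤-by-search 7 17 10 , LowerBound.lower 2
A≡-k≥4 5 _ = A≤-by-search 9 33 18 , LowerBound.lower 3
A≡-k≥4 (suc (suc (suc (suc (suc (suc e)))))) _ = UpperBound.upper e , LowerBound.lower (4 + e)

theorem1p5 : A≡ (2 ^ 1 + 1) 5
    × A≡ (2 ^ 2 + 1) 6
    × A≡ (2 ^ 3 + 1) 9
    × (∀ (k : ℕ) → 4 ≤ k → A≡ (2 ^ k + 1) (2 ^ (k ∸ 1) + 2))
theorem1p5 = (A≤-by-search 3 3 5 , 28 , A≥-by-search 28 3 5)
           , (A≤-by-search 4 5 6 , 31 , A≥-by-search 31 5 6)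
           , (A≤-by-search 6 9 9 , 43 , A≥-by-search 43 9 9)
           , A≡-k≥4
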